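{- Let $q$ be a prime power, $n\geq1$, $1\neq\sigma\in\mathrm{Aut}(\mathbb F_q)$ with fixed field $\mathbb F_s$, and let $\mathcal C(\Lambda_\sigma)=\{c_M:M\in M_{n+1}(q)\}$ be as in the context. Then $\mathrm{GL}(n+1,q)$ acts as a group of automorphisms (Hamming isometries preserving the code) of $\mathcal C(\Lambda_\sigma)$ via $\varrho(g): c_M\mapsto c_{g^{ -1}Mg^\sigma}$, and the kernel of this action is the subgroup $K_\sigma=\{\alpha I:\alpha\in\mathbb F_s\}$ of scalar matrices.
   Context: $V=\mathbb F_q^{n+1}$ (column vectors), $V^*$ row vectors; $A^\sigma$ means $\sigma$ applied entrywise. $\Lambda_\sigma=\{[x^\sigma\xi]: x\in V\setminus\{0\},\xi\in V^*\setminus\{0\},\xi x=0\}\subseteq\mathrm{PG}(M_{n+1}(q))$ with fixed representatives $X_1,\dots,X_N$ of its points, and $c_M=(\mathrm{Tr}(X_1M),\dots,\mathrm{Tr}(X_NM))\in\mathbb F_q^N$. -}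

module Defs where

open import Level using (Level; _⊔_) renaming (suc to lsuc)
open import Algebra.Bundles using (CommutativeRing)
open import Data.Nat using (ℕ; zero; suc) renaming (_+_ to _+ℕ_)
open import Data.Fin using (Fin; zero; suc)
open import Data.Bool using (Bool; true; false)
open import Data.Product using (Σ; ∃; _×_; _,_)
open import Relation.Nullary using (¬_; does)
open import Relation.Nullary.Decidable using () renaming (¬? to not?)
open import Relation.Binary.Definitions using (Decidable)
open import Relation.Binary.PropositionalEquality using (_≡_)

record FiniteField (c ℓ : Level) : Set (lsuc (c ⊔ ℓ)) where
  field
    commRing : CommutativeRing c ℓ
  open CommutativeRing commRing
  field
    1≉0       : ¬ (1# ≈ 0#)
    inverse   : ∀ x → ¬ (x ≈ 0#) → ∃ λ y → x * y ≈ 1#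
    _≟_       : Decidable _≈_
    size      : ℕ
    enum      : Fin size → Carrier
    enum-surj : ∀ x → ∃ λ i → enum i ≈ x

module _ {a} {A : Set a} (_⊕_ : A → A → A) (e : A) where
  sumFin : ∀ n → (Fin n → A) → A
  sumFin zero    f = e
  sumFin (suc n) f = f zero ⊕ sumFin n (λ i → f (suc i))

countFin : ∀ n → (Fin n → Bool) → ℕ
countFin zero    p = 0
countFin (suc n) p with p zero
... | true  = suc (countFin n (λ i → p (suc i)))
... | false = countFin n (λ i → p (suc i))

module Over {c ℓ} (F : FiniteField c ℓ) where
  open FiniteField F public
  open CommutativeRing commRing public hiding (ring)

  record Aut : Set (c ⊔ ℓ) where
    field
      σ      : Carrier → Carrier
      σ-cong : ∀ {x y} → x ≈ y → σ x ≈ σ y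
      σ-+    : ∀ x y → σ (x + y) ≈ σ x + σ y
      σ-*    : ∀ x y → σ (x * y) ≈ σ x * σ y
      σ-1    : σ 1# ≈ 1#
      σ⁻¹    : Carrier → Carrier
      σσ⁻¹   : ∀ x → σ (σ⁻¹ x) ≈ x
      σ⁻¹σ   : ∀ x → σ⁻¹ (σ x) ≈ x

  NonTrivial : Aut → Set (c ⊔ ℓ)
  NonTrivial s = ∃ λ a → ¬ (Aut.σ s a ≈ a)

  Vec : ℕ → Set c
  Vec m = Fin m → Carrier

  Mat : ℕ → Set c
  Mat m = Fin m → Fin m → Carrier

  Σ[_] : ∀ m → Vec m → Carrier
  Σ[ m ] = sumFin _+_ 0# m

  _≈ⱽ_ : ∀ {m} → Vec m → Vec m → Set ℓ
  u ≈ⱽ v = ∀ i → u i ≈ v i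

  _≈ᴹ_ : ∀ {m} → Mat m → Mat m → Set ℓ
  A ≈ᴹ B = ∀ i j → A i j ≈ B i j

  NonZeroV : ∀ {m} → Vec m → Set ℓ
  NonZeroV v = ¬ (∀ i → v i ≈ 0#)

  _∙_ : ∀ {m} → Vec m → Vec m → Carrier
  _∙_ {m} ξ x = Σ[ m ] (λ i → ξ i * x i)

  outer : ∀ {m} → Vec m → Vec m → Mat m
  outer x ξ i j = x i * ξ j

  _·ᴹ_ : ∀ {m} → Mat m → Mat m → Mat m
  _·ᴹ_ {m} A B i j = Σ[ m ] (λ k → A i k * B k j)

  I : ∀ {m} → Mat m
  I i j with Data.Fin._≟_ i j
  ... | Relation.Nullary.yes _ = 1#
  ... | Relation.Nullary.no  _ = 0#

  scalar : ∀ {m} → Carrier → Mat m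
  scalar α i j = α * I i j

  _•_ : ∀ {m} → Carrier → Mat m → Mat m
  (α • A) i j = α * A i j

  mapᴹ : ∀ {m} → (Carrier → Carrier) → Mat m → Mat m
  mapᴹ f A i j = f (A i j)

  mapⱽ : ∀ {m} → (Carrier → Carrier) → Vec m → Vec m
  mapⱽ f v i = f (v i)

  Tr : ∀ {m} → Mat m → Carrier
  Tr {m} A = Σ[ m ] (λ i → A i i)

  IsInverse : ∀ {m} → Mat m → Mat m → Set ℓ
  IsInverse g h = ((g ·ᴹ h) ≈ᴹ I) × ((h ·ᴹ g) ≈ᴹ I)

  -- X is (a representative of) a point of Λ_σ : X = x^σ ξ with x, ξ ≠ 0, ξ x = 0
  InΛ : Aut → ∀ {m} → Mat m → Set (c ⊔ ℓ)
  InΛ s {m} X = Σ (Vec m) λ x → Σ (Vec m) λ ξ →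
    NonZeroV x × NonZeroV ξ × ((ξ ∙ x) ≈ 0#) × (X ≈ᴹ outer (mapⱽ (Aut.σ s) x) ξ)

  -- same projective point
  Proportional : ∀ {m} → Mat m → Mat m → Set (c ⊔ ℓ)
  Proportional X Y = ∃ λ a → ¬ (a ≈ 0#) × (X ≈ᴹ (a • Y))

  IsRepSystem : Aut → ∀ {m} N → (Fin N → Mat m) → Set (c ⊔ ℓ)
  IsRepSystem s {m} N X =
    (∀ i → InΛ s (X i)) ×
    (∀ i j → Proportional (X i) (X j) → i ≡ j) ×
    (∀ (Y : Mat m) → InΛ s Y → ∃ λ i → Proportional Y (X i))

  code : ∀ {m N} → (Fin N → Mat m) → Mat m → Vec N
  code X M i = Tr (X i ·ᴹ M)

  dist : ∀ {N} → Vec N → Vec N → ℕ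
  dist {N} u v = countFin N (λ i → does (not? (u i ≟ v i)))

{-# OPTIONS --safe #-}

-- Through the trace form, the codeword c_{g⁻¹ M g^σ} read at X_i is c_M read at g^σ X_i g⁻¹, and
-- Y ↦ g^σ Y g⁻¹ sends x^σ ξ to (g x)^σ (ξ g⁻¹), so it permutes the points of Λ_σ while rescaling
-- their representatives. Hence ρ(g) is a monomial map (a coordinate permutation composed with nonzero
-- rescalings): it is well defined on the code and preserves Hamming distance. If ρ(g) is trivial,
-- nondegeneracy of the trace form gives g^σ X_i g⁻¹ = X_i for all i, hence g^σ Y = Y g on all of Λ_σ.
-- Testing with Y = e_a e_bᵀ (a ≠ b) shows that g is diagonal with σ(g_aa) = g_bb, and
-- Y = (e₀ + e₁)(e₀ − e₁)ᵀ gives σ(g₀₀) = g₀₀, so g = αI with α ∈ F_s.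

module Submission where

open import Defs
open import Algebra.Bundles using (CommutativeRing)
open import Data.Bool using (Bool; true; false; not; if_then_else_)
open import Data.Fin using (Fin; zero; suc)
import Data.Fin as Fin
open import Data.Fin.Permutation using (Permutation′; permutation; _⟨$⟩ʳ_)
open import Data.Fin.Properties using (punchInᵢ≢i)
open import Data.Nat using (ℕ; zero; suc; _≤_; s≤s; z≤n)
open import Data.Nat.Properties using (+-0-commutativeMonoid)
open import Data.Product using (∃; _×_; _,_; proj₁; proj₂)
open import Function.Base using (_∘_)
open import Function.Bundles using (_⇔_; mk⇔)
open import Relation.Binary.Bundles using (Setoid)
open import Relation.Binary.PropositionalEquality as ≡ using (_≡_; _≢_)
open import Relation.Nullary using (¬_; yes; no; contradiction)
open import Relation.Nullary.Decidable using (does-⇔)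
import Algebra.Properties.CommutativeMonoid.Sum as CommutativeMonoidSum
import Algebra.Properties.Ring as RingProperties
import Algebra.Properties.Semiring.Sum as SemiringSum
import Data.Vec.Functional.Relation.Binary.Equality.Setoid as VecEquality
import Relation.Binary.Reasoning.Setoid as SetoidReasoning

module SumFin {c ℓ} (R : CommutativeRing c ℓ) where
  open CommutativeRing R
  open SemiringSum semiring using (sum; sum-cong-≋; sum-replicate-zero; sum-remove;
    ∑-comm; *-distribˡ-sum; *-distribʳ-sum)

  Σ[_] : ∀ m → (Fin m → Carrier) → Carrier
  Σ[_] = sumFin _+_ 0#

  Σ≈sum : ∀ {m} (f : Fin m → Carrier) → Σ[ m ] f ≈ sum f
  Σ≈sum {zero}  f = refl
  Σ≈sum {suc m} f = +-congˡ (Σ≈sum (f ∘ suc))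

  Σ-cong : ∀ m {f g : Fin m → Carrier} → (∀ i → f i ≈ g i) → Σ[ m ] f ≈ Σ[ m ] g
  Σ-cong m {f} {g} f≈g = trans (Σ≈sum f) (trans (sum-cong-≋ f≈g) (sym (Σ≈sum g)))

  Σ-zero : ∀ m {f : Fin m → Carrier} → (∀ i → f i ≈ 0#) → Σ[ m ] f ≈ 0#
  Σ-zero m {f} f≈0 = trans (Σ≈sum f) (trans (sum-cong-≋ f≈0) (sum-replicate-zero m))

  Σ-δ : ∀ m (f : Fin m → Carrier) j → (∀ i → i ≢ j → f i ≈ 0#) → Σ[ m ] f ≈ f j
  Σ-δ (suc m) f j f≈0 = begin
    Σ[ suc m ] f                      ≈⟨ Σ≈sum f ⟩
    sum f                             ≈⟨ sum-remove f ⟩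
    f j + sum (f ∘ Fin.punchIn j)     ≈⟨ +-congˡ (sum-cong-≋ (λ i → f≈0 _ (punchInᵢ≢i j i))) ⟩
    f j + sum {m} (λ _ → 0#)          ≈⟨ +-congˡ (sum-replicate-zero m) ⟩
    f j + 0#                          ≈⟨ +-identityʳ (f j) ⟩
    f j                               ∎
    where open SetoidReasoning setoid

  Σ-comm : ∀ m k (f : Fin m → Fin k → Carrier) →
           Σ[ m ] (λ i → Σ[ k ] (f i)) ≈ Σ[ k ] (λ j → Σ[ m ] (λ i → f i j))
  Σ-comm m k f =
    trans (Σ²≈sum² m k f) (trans (∑-comm f) (sym (Σ²≈sum² k m (λ j i → f i j))))
    where
    Σ²≈sum² : ∀ m k (f : Fin m → Fin k → Carrier) →
              Σ[ m ] (λ i → Σ[ k ] (f i)) ≈ sum (λ i → sum (f i))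
    Σ²≈sum² m k f = trans (Σ-cong m (λ i → Σ≈sum (f i))) (Σ≈sum (λ i → sum (f i)))

  *-distribˡ-Σ : ∀ m x (f : Fin m → Carrier) → x * Σ[ m ] f ≈ Σ[ m ] (λ i → x * f i)
  *-distribˡ-Σ m x f =
    trans (*-congˡ (Σ≈sum f)) (trans (*-distribˡ-sum x f) (sym (Σ≈sum (λ i → x * f i))))

  *-distribʳ-Σ : ∀ m x (f : Fin m → Carrier) → Σ[ m ] f * x ≈ Σ[ m ] (λ i → f i * x)
  *-distribʳ-Σ m x f =
    trans (*-congʳ (Σ≈sum f)) (trans (*-distribʳ-sum x f) (sym (Σ≈sum (λ i → f i * x))))

module CountFin where
  open CommutativeMonoidSum +-0-commutativeMonoid using (sum; sum-cong-≗; sum-permute)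

  countFin≡sum : ∀ n (p : Fin n → Bool) → countFin n p ≡ sum (λ i → if p i then 1 else 0)
  countFin≡sum zero    p = ≡.refl
  countFin≡sum (suc n) p with p zero
  ... | true  = ≡.cong suc (countFin≡sum n (p ∘ suc))
  ... | false = countFin≡sum n (p ∘ suc)

  countFin-cong : ∀ n {p q : Fin n → Bool} → (∀ i → p i ≡ q i) → countFin n p ≡ countFin n q
  countFin-cong n {p} {q} p≡q = ≡.trans (countFin≡sum n p)
    (≡.trans (sum-cong-≗ (λ i → ≡.cong (if_then 1 else 0) (p≡q i))) (≡.sym (countFin≡sum n q)))

  countFin-permute : ∀ n (p : Fin n → Bool) (π : Permutation′ n) →
                     countFin n (p ∘ (π ⟨$⟩ʳ_)) ≡ countFin n p
  countFin-permute n p π = ≡.trans (countFin≡sum n (p ∘ (π ⟨$⟩ʳ_)))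
    (≡.trans (≡.sym (sum-permute _ π)) (≡.sym (countFin≡sum n p)))

module Field {c ℓ} (F : FiniteField c ℓ) where
  open Over F hiding (zero)

  *-cancelˡ : ∀ {a x y} → ¬ (a ≈ 0#) → a * x ≈ a * y → x ≈ y
  *-cancelˡ {a} {x} {y} a≉0 ax≈ay with inverse a a≉0
  ... | b , ab≈1 = begin
    x             ≈⟨ *-identityˡ x ⟨
    1# * x        ≈⟨ *-congʳ (trans (sym ab≈1) (*-comm a b)) ⟩
    (b * a) * x   ≈⟨ *-assoc b a x ⟩
    b * (a * x)   ≈⟨ *-congˡ ax≈ay ⟩
    b * (a * y)   ≈⟨ *-assoc b a y ⟨
    (b * a) * y   ≈⟨ *-congʳ (trans (*-comm b a) ab≈1) ⟩
    1# * y        ≈⟨ *-identityˡ y ⟩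
    y             ∎
    where open SetoidReasoning setoid

  *-≉0 : ∀ {a b} → ¬ (a ≈ 0#) → ¬ (b ≈ 0#) → ¬ (a * b ≈ 0#)
  *-≉0 {a} a≉0 b≉0 ab≈0 = b≉0 (*-cancelˡ a≉0 (trans ab≈0 (sym (zeroʳ a))))

module Matrices {c ℓ} (F : FiniteField c ℓ) where
  open Over F hiding (zero)
  open SumFin commRing hiding (Σ[_])
  open import Algebra.Properties.CommutativeSemigroup *-commutativeSemigroup using (x∙yz≈y∙xz)

  Mat-setoid : ℕ → Setoid c ℓ
  Mat-setoid m = VecEquality.≋-setoid (VecEquality.≋-setoid setoid m) m

  module ≈ᴹ-Reasoning {m} = SetoidReasoning (Mat-setoid m)

  ≈ᴹ-refl : ∀ {m} {A : Mat m} → A ≈ᴹ A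
  ≈ᴹ-refl i j = refl

  ≈ᴹ-sym : ∀ {m} {A B : Mat m} → A ≈ᴹ B → B ≈ᴹ A
  ≈ᴹ-sym A≈B i j = sym (A≈B i j)

  ≈ᴹ-trans : ∀ {m} {A B C : Mat m} → A ≈ᴹ B → B ≈ᴹ C → A ≈ᴹ C
  ≈ᴹ-trans A≈B B≈C i j = trans (A≈B i j) (B≈C i j)

  col : ∀ {m} → Mat m → Fin m → Vec m
  col A j i = A i j

  infixl 7 _·ᵛ_ _ᵛ·_

  _·ᵛ_ : ∀ {m} → Mat m → Vec m → Vec m
  (A ·ᵛ x) i = A i ∙ x

  _ᵛ·_ : ∀ {m} → Vec m → Mat m → Vec m
  (ξ ᵛ· A) j = ξ ∙ col A j

  I-diag : ∀ {m} (i : Fin m) → I i i ≈ 1#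
  I-diag i with i Fin.≟ i
  ... | yes _   = refl
  ... | no i≢i  = contradiction ≡.refl i≢i

  I-off : ∀ {m} {i j : Fin m} → i ≢ j → I i j ≈ 0#
  I-off {i = i} {j} i≢j with i Fin.≟ j
  ... | yes i≡j = contradiction i≡j i≢j
  ... | no _    = refl

  I∙ : ∀ {m} j (x : Vec m) → I j ∙ x ≈ x j
  I∙ {m} j x = trans (Σ-δ m _ j (λ k k≢j → trans (*-congʳ (I-off (k≢j ∘ ≡.sym))) (zeroˡ (x k))))
                     (trans (*-congʳ (I-diag j)) (*-identityˡ (x j)))

  ∙colI : ∀ {m} (ξ : Vec m) j → ξ ∙ col I j ≈ ξ j
  ∙colI {m} ξ j = trans (Σ-δ m _ j (λ k k≢j → trans (*-congˡ (I-off k≢j)) (zeroʳ (ξ k))))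
                        (trans (*-congˡ (I-diag j)) (*-identityʳ (ξ j)))

  ∙-cong : ∀ {m} {ξ η x y : Vec m} → ξ ≈ⱽ η → x ≈ⱽ y → ξ ∙ x ≈ η ∙ y
  ∙-cong {m} ξ≈η x≈y = Σ-cong m (λ k → *-cong (ξ≈η k) (x≈y k))

  ∙-zeroʳ : ∀ {m} (ξ : Vec m) {x : Vec m} → (∀ i → x i ≈ 0#) → ξ ∙ x ≈ 0#
  ∙-zeroʳ {m} ξ x≈0 = Σ-zero m (λ k → trans (*-congˡ (x≈0 k)) (zeroʳ (ξ k)))

  ∙-zeroˡ : ∀ {m} {ξ : Vec m} (x : Vec m) → (∀ i → ξ i ≈ 0#) → ξ ∙ x ≈ 0#
  ∙-zeroˡ {m} x ξ≈0 = Σ-zero m (λ k → trans (*-congʳ (ξ≈0 k)) (zeroˡ (x k)))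

  -- (A ·ᴹ B) i j is definitionally A i ∙ col B j, so every associativity law below is an instance.
  ∙-assoc : ∀ {m} (ξ : Vec m) (A : Mat m) (x : Vec m) → ξ ∙ (A ·ᵛ x) ≈ (ξ ᵛ· A) ∙ x
  ∙-assoc {m} ξ A x = begin
    Σ[ m ] (λ k → ξ k * Σ[ m ] (λ l → A k l * x l))
      ≈⟨ Σ-cong m (λ k → *-distribˡ-Σ m (ξ k) _) ⟩
    Σ[ m ] (λ k → Σ[ m ] (λ l → ξ k * (A k l * x l)))
      ≈⟨ Σ-comm m m _ ⟩
    Σ[ m ] (λ l → Σ[ m ] (λ k → ξ k * (A k l * x l)))
      ≈⟨ Σ-cong m (λ l → Σ-cong m (λ k → sym (*-assoc _ _ _))) ⟩
    Σ[ m ] (λ l → Σ[ m ] (λ k → (ξ k * A k l) * x l))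
      ≈⟨ Σ-cong m (λ l → sym (*-distribʳ-Σ m (x l) _)) ⟩
    Σ[ m ] (λ l → Σ[ m ] (λ k → ξ k * A k l) * x l)
      ∎
    where open SetoidReasoning setoid

  ·ᴹ-cong : ∀ {m} {A A' B B' : Mat m} → A ≈ᴹ A' → B ≈ᴹ B' → (A ·ᴹ B) ≈ᴹ (A' ·ᴹ B')
  ·ᴹ-cong A≈A' B≈B' i j = ∙-cong (A≈A' i) (λ k → B≈B' k j)

  ·ᴹ-assoc : ∀ {m} (A B C : Mat m) → ((A ·ᴹ B) ·ᴹ C) ≈ᴹ (A ·ᴹ (B ·ᴹ C))
  ·ᴹ-assoc A B C i j = sym (∙-assoc (A i) B (col C j))

  ·ᴹ-identityˡ : ∀ {m} (A : Mat m) → (I ·ᴹ A) ≈ᴹ A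
  ·ᴹ-identityˡ A i j = I∙ i (col A j)

  ·ᴹ-identityʳ : ∀ {m} (A : Mat m) → (A ·ᴹ I) ≈ᴹ A
  ·ᴹ-identityʳ A i j = ∙colI (A i) j

  ·ᵛ-cong : ∀ {m} {A B : Mat m} {x y : Vec m} → A ≈ᴹ B → x ≈ⱽ y → (A ·ᵛ x) ≈ⱽ (B ·ᵛ y)
  ·ᵛ-cong A≈B x≈y i = ∙-cong (A≈B i) x≈y

  ·ᵛ-cancel : ∀ {m} {g h : Mat m} → (h ·ᴹ g) ≈ᴹ I → ∀ x → (h ·ᵛ (g ·ᵛ x)) ≈ⱽ x
  ·ᵛ-cancel {g = g} {h} hg≈I x i =
    trans (∙-assoc (h i) g x) (trans (·ᵛ-cong hg≈I (λ _ → refl) i) (I∙ i x))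

  ᵛ·-cancel : ∀ {m} {g h : Mat m} → (h ·ᴹ g) ≈ᴹ I → ∀ ξ → ((ξ ᵛ· h) ᵛ· g) ≈ⱽ ξ
  ᵛ·-cancel {g = g} {h} hg≈I ξ j =
    trans (sym (∙-assoc ξ h (col g j))) (trans (∙-cong (λ _ → refl) (λ k → hg≈I k j)) (∙colI ξ j))


  ·ᵛ-≉0 : ∀ {m} {g h : Mat m} {x : Vec m} → (h ·ᴹ g) ≈ᴹ I → NonZeroV x → NonZeroV (g ·ᵛ x)
  ·ᵛ-≉0 {g = g} {h} {x} hg≈I x≉0 gx≈0 =
    x≉0 (λ i → trans (sym (·ᵛ-cancel hg≈I x i)) (∙-zeroʳ (h i) gx≈0))

  ᵛ·-≉0 : ∀ {m} {g h : Mat m} {ξ : Vec m} → (h ·ᴹ g) ≈ᴹ I → NonZeroV ξ → NonZeroV (ξ ᵛ· h)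
  ᵛ·-≉0 {g = g} {h} {ξ} hg≈I ξ≉0 ξh≈0 =
    ξ≉0 (λ j → trans (sym (ᵛ·-cancel hg≈I ξ j)) (∙-zeroˡ (col g j) ξh≈0))

  outer-cong : ∀ {m} {x y ξ η : Vec m} → x ≈ⱽ y → ξ ≈ⱽ η → outer x ξ ≈ᴹ outer y η
  outer-cong x≈y ξ≈η i j = *-cong (x≈y i) (ξ≈η j)

  ·ᴹ-outer : ∀ {m} (A : Mat m) (x ξ : Vec m) → (A ·ᴹ outer x ξ) ≈ᴹ outer (A ·ᵛ x) ξ
  ·ᴹ-outer {m} A x ξ i j =
    trans (Σ-cong m (λ k → sym (*-assoc _ _ _))) (sym (*-distribʳ-Σ m (ξ j) _))

  outer-·ᴹ : ∀ {m} (x ξ : Vec m) (B : Mat m) → (outer x ξ ·ᴹ B) ≈ᴹ outer x (ξ ᵛ· B)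
  outer-·ᴹ {m} x ξ B i j =
    trans (Σ-cong m (λ k → *-assoc _ _ _)) (sym (*-distribˡ-Σ m (x i) _))

  •-cong : ∀ {m} {a b} {A B : Mat m} → a ≈ b → A ≈ᴹ B → (a • A) ≈ᴹ (b • B)
  •-cong a≈b A≈B i j = *-cong a≈b (A≈B i j)

  •-assoc : ∀ {m} a b (A : Mat m) → (a • (b • A)) ≈ᴹ ((a * b) • A)
  •-assoc a b A i j = sym (*-assoc a b (A i j))

  •-·ᴹ : ∀ {m} a (A B : Mat m) → ((a • A) ·ᴹ B) ≈ᴹ (a • (A ·ᴹ B))
  •-·ᴹ {m} a A B i j = trans (Σ-cong m (λ k → *-assoc _ _ _)) (sym (*-distribˡ-Σ m a _))

  ·ᴹ-• : ∀ {m} a (A B : Mat m) → (A ·ᴹ (a • B)) ≈ᴹ (a • (A ·ᴹ B))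
  ·ᴹ-• {m} a A B i j = trans (Σ-cong m (λ k → x∙yz≈y∙xz _ _ _)) (sym (*-distribˡ-Σ m a _))

  scalar-·ᴹ : ∀ {m} α (A : Mat m) → (scalar α ·ᴹ A) ≈ᴹ (α • A)
  scalar-·ᴹ α A = ≈ᴹ-trans (•-·ᴹ α I A) (•-cong refl (·ᴹ-identityˡ A))

  ·ᴹ-scalar : ∀ {m} α (A : Mat m) → (A ·ᴹ scalar α) ≈ᴹ (α • A)
  ·ᴹ-scalar α A = ≈ᴹ-trans (·ᴹ-• α A I) (•-cong refl (·ᴹ-identityʳ A))

  diagonal⇒scalar : ∀ {m} {A : Mat m} {α} →
    (∀ i j → i ≢ j → A i j ≈ 0#) → (∀ i → A i i ≈ α) → A ≈ᴹ scalar α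
  diagonal⇒scalar {α = α} A-off A-diag i j with i Fin.≟ j
  ... | yes ≡.refl = trans (A-diag i) (sym (*-identityʳ α))
  ... | no i≢j    = trans (A-off i j i≢j) (sym (zeroʳ α))

  Tr-cong : ∀ {m} {A B : Mat m} → A ≈ᴹ B → Tr A ≈ Tr B
  Tr-cong {m} A≈B = Σ-cong m (λ i → A≈B i i)

  Tr-• : ∀ {m} a (A : Mat m) → Tr (a • A) ≈ a * Tr A
  Tr-• {m} a A = sym (*-distribˡ-Σ m a _)

  Tr-cyclic : ∀ {m} (A B : Mat m) → Tr (A ·ᴹ B) ≈ Tr (B ·ᴹ A)
  Tr-cyclic {m} A B =
    trans (Σ-comm m m _) (Σ-cong m (λ k → Σ-cong m (λ i → *-comm (A i k) (B k i))))

  Tr-sandwich : ∀ {m} (Y H M G : Mat m) →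
    Tr (Y ·ᴹ ((H ·ᴹ M) ·ᴹ G)) ≈ Tr (((G ·ᴹ Y) ·ᴹ H) ·ᴹ M)
  Tr-sandwich Y H M G = begin
    Tr (Y ·ᴹ ((H ·ᴹ M) ·ᴹ G))      ≈⟨ Tr-cyclic Y _ ⟩
    Tr (((H ·ᴹ M) ·ᴹ G) ·ᴹ Y)      ≈⟨ Tr-cong (·ᴹ-assoc (H ·ᴹ M) G Y) ⟩
    Tr ((H ·ᴹ M) ·ᴹ (G ·ᴹ Y))      ≈⟨ Tr-cyclic (H ·ᴹ M) _ ⟩
    Tr ((G ·ᴹ Y) ·ᴹ (H ·ᴹ M))      ≈⟨ Tr-cong (≈ᴹ-sym (·ᴹ-assoc (G ·ᴹ Y) H M)) ⟩
    Tr (((G ·ᴹ Y) ·ᴹ H) ·ᴹ M)      ∎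
    where open SetoidReasoning setoid

  Tr-·ᴹ-unit : ∀ {m} (A : Mat m) i j → Tr (A ·ᴹ outer (col I j) (col I i)) ≈ A i j
  Tr-·ᴹ-unit A i j = begin
    Tr (A ·ᴹ outer (col I j) (col I i))   ≈⟨ Tr-cong (·ᴹ-outer A (col I j) (col I i)) ⟩
    (A ·ᵛ col I j) ∙ col I i              ≈⟨ ∙colI (A ·ᵛ col I j) i ⟩
    A i ∙ col I j                         ≈⟨ ∙colI (A i) j ⟩
    A i j                                 ∎
    where open SetoidReasoning setoid

  Tr-·ᴹ-injective : ∀ {m} {A B : Mat m} → (∀ M → Tr (A ·ᴹ M) ≈ Tr (B ·ᴹ M)) → A ≈ᴹ B
  Tr-·ᴹ-injective {A = A} {B} trA≈trB i j = begin
    A i j                                   ≈⟨ sym (Tr-·ᴹ-unit A i j) ⟩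
    Tr (A ·ᴹ outer (col I j) (col I i))     ≈⟨ trA≈trB _ ⟩
    Tr (B ·ᴹ outer (col I j) (col I i))     ≈⟨ Tr-·ᴹ-unit B i j ⟩
    B i j                                   ∎
    where open SetoidReasoning setoid

  IsInverse-sym : ∀ {m} {g h : Mat m} → IsInverse g h → IsInverse h g
  IsInverse-sym (gh≈I , hg≈I) = hg≈I , gh≈I

  inverse-unique : ∀ {m} {k A B : Mat m} → (k ·ᴹ A) ≈ᴹ I → (A ·ᴹ B) ≈ᴹ I → k ≈ᴹ B
  inverse-unique {k = k} {A} {B} kA≈I AB≈I = begin
    k                  ≈⟨ ·ᴹ-identityʳ k ⟨
    k ·ᴹ I             ≈⟨ ·ᴹ-cong ≈ᴹ-refl AB≈I ⟨
    k ·ᴹ (A ·ᴹ B)      ≈⟨ ·ᴹ-assoc k A B ⟨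
    (k ·ᴹ A) ·ᴹ B      ≈⟨ ·ᴹ-cong kA≈I ≈ᴹ-refl ⟩
    I ·ᴹ B             ≈⟨ ·ᴹ-identityˡ B ⟩
    B                  ∎
    where open ≈ᴹ-Reasoning

  ·ᴹ-inverseʳ : ∀ {m} {g h g' h' : Mat m} → IsInverse g h → IsInverse g' h' →
    ((g ·ᴹ g') ·ᴹ (h' ·ᴹ h)) ≈ᴹ I
  ·ᴹ-inverseʳ {g = g} {h} {g'} {h'} (gh≈I , _) (g'h'≈I , _) = begin
    (g ·ᴹ g') ·ᴹ (h' ·ᴹ h)     ≈⟨ ·ᴹ-assoc g g' _ ⟩
    g ·ᴹ (g' ·ᴹ (h' ·ᴹ h))     ≈⟨ ·ᴹ-cong ≈ᴹ-refl (·ᴹ-assoc g' h' h) ⟨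
    g ·ᴹ ((g' ·ᴹ h') ·ᴹ h)     ≈⟨ ·ᴹ-cong ≈ᴹ-refl (·ᴹ-cong g'h'≈I ≈ᴹ-refl) ⟩
    g ·ᴹ (I ·ᴹ h)              ≈⟨ ·ᴹ-cong ≈ᴹ-refl (·ᴹ-identityˡ h) ⟩
    g ·ᴹ h                     ≈⟨ gh≈I ⟩
    I                          ∎
    where open ≈ᴹ-Reasoning

  sandwich-assoc : ∀ {m} (A B M C D : Mat m) →
    ((A ·ᴹ ((B ·ᴹ M) ·ᴹ C)) ·ᴹ D) ≈ᴹ (((A ·ᴹ B) ·ᴹ M) ·ᴹ (C ·ᴹ D))
  sandwich-assoc A B M C D = begin
    (A ·ᴹ ((B ·ᴹ M) ·ᴹ C)) ·ᴹ D     ≈⟨ ·ᴹ-cong (·ᴹ-assoc A (B ·ᴹ M) C) ≈ᴹ-refl ⟨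
    ((A ·ᴹ (B ·ᴹ M)) ·ᴹ C) ·ᴹ D     ≈⟨ ·ᴹ-assoc _ C D ⟩
    (A ·ᴹ (B ·ᴹ M)) ·ᴹ (C ·ᴹ D)     ≈⟨ ·ᴹ-cong (·ᴹ-assoc A B M) ≈ᴹ-refl ⟨
    ((A ·ᴹ B) ·ᴹ M) ·ᴹ (C ·ᴹ D)     ∎
    where open ≈ᴹ-Reasoning

  diagonal-·ᵛ : ∀ {m} {A : Mat m} → (∀ i j → i ≢ j → A i j ≈ 0#) → ∀ x k → (A ·ᵛ x) k ≈ A k k * x k
  diagonal-·ᵛ {m} A-off x k =
    Σ-δ m _ k (λ j j≢k → trans (*-congʳ (A-off k j (j≢k ∘ ≡.sym))) (zeroˡ (x j)))

  diagonal-ᵛ· : ∀ {m} {A : Mat m} → (∀ i j → i ≢ j → A i j ≈ 0#) → ∀ ξ l → (ξ ᵛ· A) l ≈ ξ l * A l l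
  diagonal-ᵛ· {m} A-off ξ l =
    Σ-δ m _ l (λ j j≢l → trans (*-congˡ (A-off j l j≢l)) (zeroʳ (ξ j)))

module Semilinear {c ℓ} (F : FiniteField c ℓ) (s : Over.Aut F) where
  open Over F hiding (zero)
  open Aut s
  open SumFin commRing hiding (Σ[_])
  open Matrices F
  open RingProperties (CommutativeRing.ring commRing) using (x+x≈x⇒x≈0)

  σ-0 : σ 0# ≈ 0#
  σ-0 = x+x≈x⇒x≈0 _ (trans (sym (σ-+ 0# 0#)) (σ-cong (+-identityˡ 0#)))

  -- Aut gives no congruence for σ⁻¹, so injectivity goes through inverses instead.
  σ-≈0⇒≈0 : ∀ {x} → σ x ≈ 0# → x ≈ 0#
  σ-≈0⇒≈0 {x} σx≈0 with x ≟ 0#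
  ... | yes x≈0 = x≈0
  ... | no x≉0 with inverse x x≉0
  ... | y , xy≈1 = contradiction (begin
    1#          ≈⟨ σ-1 ⟨
    σ 1#        ≈⟨ σ-cong xy≈1 ⟨
    σ (x * y)   ≈⟨ σ-* x y ⟩
    σ x * σ y   ≈⟨ *-congʳ σx≈0 ⟩
    0# * σ y    ≈⟨ zeroˡ (σ y) ⟩
    0#          ∎) 1≉0
    where open SetoidReasoning setoid

  σ-Σ : ∀ m (f : Vec m) → σ (Σ[ m ] f) ≈ Σ[ m ] (λ i → σ (f i))
  σ-Σ zero    f = σ-0
  σ-Σ (suc m) f = trans (σ-+ _ _) (+-congˡ (σ-Σ m (f ∘ suc)))

  σ-∙ : ∀ {m} (ξ x : Vec m) → σ (ξ ∙ x) ≈ mapⱽ σ ξ ∙ mapⱽ σ x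
  σ-∙ {m} ξ x = trans (σ-Σ m _) (Σ-cong m (λ k → σ-* (ξ k) (x k)))

  σ-I : ∀ {m} (i j : Fin m) → σ (I i j) ≈ I i j
  σ-I i j with i Fin.≟ j
  ... | yes _ = σ-1
  ... | no _  = σ-0

  mapᴹσ-·ᴹ : ∀ {m} (A B : Mat m) → mapᴹ σ (A ·ᴹ B) ≈ᴹ (mapᴹ σ A ·ᴹ mapᴹ σ B)
  mapᴹσ-·ᴹ A B i j = σ-∙ (A i) (col B j)

  mapⱽσ-·ᵛ : ∀ {m} (A : Mat m) (x : Vec m) → mapⱽ σ (A ·ᵛ x) ≈ⱽ (mapᴹ σ A ·ᵛ mapⱽ σ x)
  mapⱽσ-·ᵛ A x i = σ-∙ (A i) x

  mapᴹσ-I : ∀ {m} → mapᴹ σ (I {m}) ≈ᴹ I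
  mapᴹσ-I = σ-I

  mapᴹσ-scalar : ∀ {m} {α} → σ α ≈ α → mapᴹ σ (scalar {m} α) ≈ᴹ scalar α
  mapᴹσ-scalar σα≈α i j = trans (σ-* _ _) (*-cong σα≈α (σ-I i j))

  twistedConj : ∀ {m} → Mat m → Mat m → Mat m → Mat m
  twistedConj g h Y = (mapᴹ σ g ·ᴹ Y) ·ᴹ h

  twistedConj-cong : ∀ {m} (g h : Mat m) {Y Y'} → Y ≈ᴹ Y' → twistedConj g h Y ≈ᴹ twistedConj g h Y'
  twistedConj-cong g h Y≈Y' = ·ᴹ-cong (·ᴹ-cong ≈ᴹ-refl Y≈Y') ≈ᴹ-refl

  twistedConj-• : ∀ {m} (g h : Mat m) a Y → twistedConj g h (a • Y) ≈ᴹ (a • twistedConj g h Y)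
  twistedConj-• g h a Y = ≈ᴹ-trans (·ᴹ-cong (·ᴹ-• a (mapᴹ σ g) Y) ≈ᴹ-refl) (•-·ᴹ a _ h)

  twistedConj-outer : ∀ {m} (g h : Mat m) x ξ →
    twistedConj g h (outer (mapⱽ σ x) ξ) ≈ᴹ outer (mapⱽ σ (g ·ᵛ x)) (ξ ᵛ· h)
  twistedConj-outer g h x ξ = begin
    (mapᴹ σ g ·ᴹ outer (mapⱽ σ x) ξ) ·ᴹ h
      ≈⟨ ·ᴹ-cong (·ᴹ-outer (mapᴹ σ g) (mapⱽ σ x) ξ) ≈ᴹ-refl ⟩
    outer (mapᴹ σ g ·ᵛ mapⱽ σ x) ξ ·ᴹ h       ≈⟨ outer-·ᴹ _ ξ h ⟩
    outer (mapᴹ σ g ·ᵛ mapⱽ σ x) (ξ ᵛ· h)     ≈⟨ outer-cong (mapⱽσ-·ᵛ g x) (λ _ → refl) ⟨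
    outer (mapⱽ σ (g ·ᵛ x)) (ξ ᵛ· h)          ∎
    where open ≈ᴹ-Reasoning

  twistedConj-InΛ : ∀ {m} {g h : Mat m} → IsInverse g h →
    ∀ {Y} → InΛ s Y → InΛ s (twistedConj g h Y)
  twistedConj-InΛ {g = g} {h} (_ , hg≈I) {Y} (x , ξ , x≉0 , ξ≉0 , ξx≈0 , Y≈xξ) =
    g ·ᵛ x , ξ ᵛ· h , ·ᵛ-≉0 hg≈I x≉0 , ᵛ·-≉0 hg≈I ξ≉0 , ξhgx≈0 ,
    ≈ᴹ-trans (twistedConj-cong g h Y≈xξ) (twistedConj-outer g h x ξ)
    where
    ξhgx≈0 : (ξ ᵛ· h) ∙ (g ·ᵛ x) ≈ 0#
    ξhgx≈0 = begin
      (ξ ᵛ· h) ∙ (g ·ᵛ x)    ≈⟨ ∙-assoc ξ h (g ·ᵛ x) ⟨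
      ξ ∙ (h ·ᵛ (g ·ᵛ x))    ≈⟨ ∙-cong (λ _ → refl) (·ᵛ-cancel hg≈I x) ⟩
      ξ ∙ x                  ≈⟨ ξx≈0 ⟩
      0#                     ∎
      where open SetoidReasoning setoid

  twistedConj-inverse : ∀ {m} {g h : Mat m} → IsInverse g h →
    ∀ Y → twistedConj h g (twistedConj g h Y) ≈ᴹ Y
  twistedConj-inverse {g = g} {h} (_ , hg≈I) Y = begin
    (mapᴹ σ h ·ᴹ ((mapᴹ σ g ·ᴹ Y) ·ᴹ h)) ·ᴹ g   ≈⟨ sandwich-assoc (mapᴹ σ h) (mapᴹ σ g) Y h g ⟩
    ((mapᴹ σ h ·ᴹ mapᴹ σ g) ·ᴹ Y) ·ᴹ (h ·ᴹ g)
      ≈⟨ ·ᴹ-cong (·ᴹ-cong (≈ᴹ-sym (mapᴹσ-·ᴹ h g)) ≈ᴹ-refl) hg≈I ⟩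
    (mapᴹ σ (h ·ᴹ g) ·ᴹ Y) ·ᴹ I
      ≈⟨ ·ᴹ-cong (·ᴹ-cong (λ i j → σ-cong (hg≈I i j)) ≈ᴹ-refl) ≈ᴹ-refl ⟩
    (mapᴹ σ I ·ᴹ Y) ·ᴹ I                        ≈⟨ ·ᴹ-identityʳ _ ⟩
    mapᴹ σ I ·ᴹ Y                               ≈⟨ ·ᴹ-cong mapᴹσ-I ≈ᴹ-refl ⟩
    I ·ᴹ Y                                      ≈⟨ ·ᴹ-identityˡ Y ⟩
    Y                                           ∎
    where open ≈ᴹ-Reasoning

  twistedConj-fixed⇒commutes : ∀ {m} {g h Y : Mat m} → IsInverse g h →
    twistedConj g h Y ≈ᴹ Y → (mapᴹ σ g ·ᴹ Y) ≈ᴹ (Y ·ᴹ g)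
  twistedConj-fixed⇒commutes {g = g} {h} {Y} (_ , hg≈I) fixed = begin
    mapᴹ σ g ·ᴹ Y                   ≈⟨ ·ᴹ-identityʳ _ ⟨
    (mapᴹ σ g ·ᴹ Y) ·ᴹ I            ≈⟨ ·ᴹ-cong ≈ᴹ-refl hg≈I ⟨
    (mapᴹ σ g ·ᴹ Y) ·ᴹ (h ·ᴹ g)     ≈⟨ ·ᴹ-assoc _ h g ⟨
    twistedConj g h Y ·ᴹ g          ≈⟨ ·ᴹ-cong fixed ≈ᴹ-refl ⟩
    Y ·ᴹ g                          ∎
    where open ≈ᴹ-Reasoning

  act : ∀ {m} → Mat m → Mat m → Mat m → Mat m
  act g h M = (h ·ᴹ M) ·ᴹ mapᴹ σ g

  act-identity : ∀ {m} (M : Mat m) → act I I M ≈ᴹ M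
  act-identity M = ≈ᴹ-trans (·ᴹ-cong (·ᴹ-identityˡ M) mapᴹσ-I) (·ᴹ-identityʳ M)

  act-∘ : ∀ {m} (g h g' h' k : Mat m) → IsInverse g h → IsInverse g' h' → IsInverse (g ·ᴹ g') k →
    ∀ M → act (g ·ᴹ g') k M ≈ᴹ act g' h' (act g h M)
  act-∘ g h g' h' k inv inv' (_ , kgg'≈I) M = begin
    (k ·ᴹ M) ·ᴹ mapᴹ σ (g ·ᴹ g')
      ≈⟨ ·ᴹ-cong (·ᴹ-cong k≈h'h ≈ᴹ-refl) (mapᴹσ-·ᴹ g g') ⟩
    ((h' ·ᴹ h) ·ᴹ M) ·ᴹ (mapᴹ σ g ·ᴹ mapᴹ σ g')    ≈⟨ sandwich-assoc h' h M (mapᴹ σ g) (mapᴹ σ g') ⟨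
    (h' ·ᴹ ((h ·ᴹ M) ·ᴹ mapᴹ σ g)) ·ᴹ mapᴹ σ g'    ∎
    where
    open ≈ᴹ-Reasoning
    k≈h'h : k ≈ᴹ (h' ·ᴹ h)
    k≈h'h = inverse-unique kgg'≈I (·ᴹ-inverseʳ inv inv')

  act-scalar : ∀ {m} (g h : Mat m) → IsInverse g h → ∀ {α} → σ α ≈ α → g ≈ᴹ scalar α →
    ∀ M → act g h M ≈ᴹ M
  act-scalar g h (gh≈I , _) {α} σα≈α g≈α M = begin
    (h ·ᴹ M) ·ᴹ mapᴹ σ g           ≈⟨ ·ᴹ-cong ≈ᴹ-refl g^σ≈α ⟩
    (h ·ᴹ M) ·ᴹ scalar α           ≈⟨ ·ᴹ-scalar α (h ·ᴹ M) ⟩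
    α • (h ·ᴹ M)                   ≈⟨ •-·ᴹ α h M ⟨
    (α • h) ·ᴹ M                   ≈⟨ ·ᴹ-cong (scalar-·ᴹ α h) ≈ᴹ-refl ⟨
    (scalar α ·ᴹ h) ·ᴹ M           ≈⟨ ·ᴹ-cong (·ᴹ-cong (≈ᴹ-sym g≈α) ≈ᴹ-refl) ≈ᴹ-refl ⟩
    (g ·ᴹ h) ·ᴹ M                  ≈⟨ ·ᴹ-cong gh≈I ≈ᴹ-refl ⟩
    I ·ᴹ M                         ≈⟨ ·ᴹ-identityˡ M ⟩
    M                              ∎
    where
    open ≈ᴹ-Reasoning
    g^σ≈α : mapᴹ σ g ≈ᴹ scalar α
    g^σ≈α = ≈ᴹ-trans (λ i j → σ-cong (g≈α i j)) (mapᴹσ-scalar σα≈α)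

module ScalarKernel {c ℓ} (F : FiniteField c ℓ) (s : Over.Aut F) where
  open Over F hiding (zero)
  open Aut s
  open SumFin commRing using (Σ-zero)
  open Matrices F
  open Semilinear F s

  commutes-outer : ∀ {m} (g : Mat m) x ξ →
    (mapᴹ σ g ·ᴹ outer (mapⱽ σ x) ξ) ≈ᴹ (outer (mapⱽ σ x) ξ ·ᴹ g) →
    ∀ k l → σ ((g ·ᵛ x) k) * ξ l ≈ σ (x k) * (ξ ᵛ· g) l
  commutes-outer g x ξ commutes k l = begin
    σ ((g ·ᵛ x) k) * ξ l                 ≈⟨ *-congʳ (mapⱽσ-·ᵛ g x k) ⟩
    (mapᴹ σ g ·ᵛ mapⱽ σ x) k * ξ l       ≈⟨ ·ᴹ-outer (mapᴹ σ g) (mapⱽ σ x) ξ k l ⟨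
    (mapᴹ σ g ·ᴹ outer (mapⱽ σ x) ξ) k l ≈⟨ commutes k l ⟩
    (outer (mapⱽ σ x) ξ ·ᴹ g) k l        ≈⟨ outer-·ᴹ (mapⱽ σ x) ξ g k l ⟩
    σ (x k) * (ξ ᵛ· g) l                 ∎
    where open SetoidReasoning setoid

  module _ {n} (g : Mat (suc (suc n)))
           (commutes : ∀ Y → InΛ s Y → (mapᴹ σ g ·ᴹ Y) ≈ᴹ (Y ·ᴹ g)) where

    private
      m : ℕ
      m = suc (suc n)

      other : Fin m → Fin m
      other zero    = suc zero
      other (suc _) = zero

      other-≢ : ∀ a → a ≢ other a
      other-≢ zero    ()
      other-≢ (suc _) ()

    unit-InΛ : ∀ {a b : Fin m} → a ≢ b → InΛ s (outer (mapⱽ σ (col I a)) (I b))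
    unit-InΛ {a} {b} a≢b =
      col I a , I b , (λ x≈0 → 1≉0 (trans (sym (I-diag a)) (x≈0 a))) ,
      (λ ξ≈0 → 1≉0 (trans (sym (I-diag b)) (ξ≈0 b))) ,
      trans (I∙ b (col I a)) (I-off (a≢b ∘ ≡.sym)) , ≈ᴹ-refl

    σ-column : ∀ {a b} → a ≢ b → ∀ k → σ (g k a) ≈ I k a * g b b
    σ-column {a} {b} a≢b k = begin
      σ (g k a)                          ≈⟨ *-identityʳ _ ⟨
      σ (g k a) * 1#                     ≈⟨ *-cong (σ-cong (∙colI (g k) a)) (I-diag b) ⟨
      σ ((g ·ᵛ col I a) k) * I b b
        ≈⟨ commutes-outer g (col I a) (I b) (commutes _ (unit-InΛ a≢b)) k b ⟩
      σ (I k a) * (I b ᵛ· g) b           ≈⟨ *-cong (σ-I k a) (I∙ b (col g b)) ⟩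
      I k a * g b b                      ∎
      where open SetoidReasoning setoid

    off-diagonal : ∀ i j → i ≢ j → g i j ≈ 0#
    off-diagonal i j i≢j =
      σ-≈0⇒≈0 (trans (σ-column (other-≢ j) i) (trans (*-congʳ (I-off i≢j)) (zeroˡ _)))

    σ-diagonal : ∀ {a b} → a ≢ b → σ (g a a) ≈ g b b
    σ-diagonal {a} {b} a≢b = trans (σ-column a≢b a) (trans (*-congʳ (I-diag a)) (*-identityˡ _))

    private
      x₀ ξ₀ : Vec m
      x₀ zero          = 1#
      x₀ (suc zero)    = 1#
      x₀ (suc (suc _)) = 0#
      ξ₀ zero          = 1#
      ξ₀ (suc zero)    = - 1#
      ξ₀ (suc (suc _)) = 0#

    ξ₀∙x₀≈0 : ξ₀ ∙ x₀ ≈ 0#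
    ξ₀∙x₀≈0 = begin
      1# * 1# + (- 1# * 1# + Σ[ n ] (λ _ → 0# * 0#))
        ≈⟨ +-cong (*-identityˡ 1#) (+-cong (*-identityʳ (- 1#)) (Σ-zero n (λ _ → zeroˡ 0#))) ⟩
      1# + (- 1# + 0#)                                  ≈⟨ +-congˡ (+-identityʳ (- 1#)) ⟩
      1# + - 1#                                         ≈⟨ -‿inverseʳ 1# ⟩
      0#                                                ∎
      where open SetoidReasoning setoid

    x₀ξ₀-InΛ : InΛ s (outer (mapⱽ σ x₀) ξ₀)
    x₀ξ₀-InΛ = x₀ , ξ₀ , (λ x₀≈0 → 1≉0 (x₀≈0 zero)) , (λ ξ₀≈0 → 1≉0 (ξ₀≈0 zero)) , ξ₀∙x₀≈0 , ≈ᴹ-refl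

    σ-fixes-g₀₀ : σ (g zero zero) ≈ g zero zero
    σ-fixes-g₀₀ = begin
      σ (g zero zero)                         ≈⟨ σ-cong (*-identityʳ _) ⟨
      σ (g zero zero * 1#)                    ≈⟨ *-identityʳ _ ⟨
      σ (g zero zero * 1#) * 1#
        ≈⟨ *-congʳ (σ-cong (diagonal-·ᵛ off-diagonal x₀ zero)) ⟨
      σ ((g ·ᵛ x₀) zero) * ξ₀ zero
        ≈⟨ commutes-outer g x₀ ξ₀ (commutes _ x₀ξ₀-InΛ) zero zero ⟩
      σ 1# * (ξ₀ ᵛ· g) zero                   ≈⟨ *-cong σ-1 (diagonal-ᵛ· off-diagonal ξ₀ zero) ⟩
      1# * (1# * g zero zero)                 ≈⟨ trans (*-identityˡ _) (*-identityˡ _) ⟩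
      g zero zero                             ∎
      where open SetoidReasoning setoid

    commutes-Λ⇒scalar : ∃ λ α → σ α ≈ α × g ≈ᴹ scalar α
    commutes-Λ⇒scalar = g zero zero , σ-fixes-g₀₀ , diagonal⇒scalar off-diagonal diagonal
      where
      diagonal : ∀ i → g i i ≈ g zero zero
      diagonal zero    = refl
      diagonal (suc i) = trans (sym (σ-diagonal (λ ()))) σ-fixes-g₀₀

module Hamming {c ℓ} (F : FiniteField c ℓ) where
  open Over F hiding (zero)
  open Field F using (*-cancelˡ)
  open CountFin

  dist-cong-⇔ : ∀ {N} {u v u' v' : Vec N} → (∀ i → (u i ≈ v i) ⇔ (u' i ≈ v' i)) →
    dist u v ≡ dist u' v'
  dist-cong-⇔ {N} {u} {v} {u'} {v'} u≈v⇔u'≈v' =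
    countFin-cong N (λ i → ≡.cong not (does-⇔ (u≈v⇔u'≈v' i) (u i ≟ v i) (u' i ≟ v' i)))

  dist-permute : ∀ {N} (π : Permutation′ N) (u v : Vec N) →
    dist (u ∘ (π ⟨$⟩ʳ_)) (v ∘ (π ⟨$⟩ʳ_)) ≡ dist u v
  dist-permute {N} π u v = countFin-permute N _ π

  dist-monomial : ∀ {N} (π : Permutation′ N) {κ : Vec N} → (∀ i → ¬ (κ i ≈ 0#)) →
    ∀ {u v u' v' : Vec N} → (∀ i → u' i ≈ κ i * u (π ⟨$⟩ʳ i)) → (∀ i → v' i ≈ κ i * v (π ⟨$⟩ʳ i)) →
    dist u' v' ≡ dist u v
  dist-monomial π κ≉0 {u} {v} {u'} {v'} u'≈κu v'≈κv =
    ≡.trans (dist-cong-⇔ (λ i → mk⇔ (to i) (from i))) (dist-permute π u v)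
    where
    to : ∀ i → u' i ≈ v' i → u (π ⟨$⟩ʳ i) ≈ v (π ⟨$⟩ʳ i)
    to i u'≈v' = *-cancelˡ (κ≉0 i) (trans (sym (u'≈κu i)) (trans u'≈v' (v'≈κv i)))
    from : ∀ i → u (π ⟨$⟩ʳ i) ≈ v (π ⟨$⟩ʳ i) → u' i ≈ v' i
    from i u≈v = trans (u'≈κu i) (trans (*-congˡ u≈v) (sym (v'≈κv i)))

module CodeAction {c ℓ} (F : FiniteField c ℓ) (s : Over.Aut F) {m N : ℕ}
                  (X : Fin N → Over.Mat F m) (rep : Over.IsRepSystem F s N X) where
  open Over F hiding (zero)
  open Aut s
  open Field F using (*-≉0)
  open Matrices F
  open Semilinear F s
  open Hamming F

  private
    X-InΛ : ∀ i → InΛ s (X i)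
    X-InΛ = proj₁ rep

    X-distinct : ∀ i j → Proportional (X i) (X j) → i ≡ j
    X-distinct = proj₁ (proj₂ rep)

    X-complete : ∀ Y → InΛ s Y → ∃ λ j → Proportional Y (X j)
    X-complete = proj₂ (proj₂ rep)

  code-cong : ∀ {M M'} → M ≈ᴹ M' → code X M ≈ⱽ code X M'
  code-cong M≈M' i = Tr-cong (·ᴹ-cong ≈ᴹ-refl M≈M')

  code-act : ∀ g h M i → code X (act g h M) i ≈ Tr (twistedConj g h (X i) ·ᴹ M)
  code-act g h M i = Tr-sandwich (X i) h M (mapᴹ σ g)

  module _ {g h : Mat m} (inv : IsInverse g h) where

    private
      image : ∀ i → ∃ λ j → Proportional (twistedConj g h (X i)) (X j)
      image i = X-complete _ (twistedConj-InΛ inv (X-InΛ i))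

    π : Fin N → Fin N
    π i = proj₁ (image i)

    κ : Fin N → Carrier
    κ i = proj₁ (proj₂ (image i))

    κ-≉0 : ∀ i → ¬ (κ i ≈ 0#)
    κ-≉0 i = proj₁ (proj₂ (proj₂ (image i)))

    twistedConj-X : ∀ i → twistedConj g h (X i) ≈ᴹ (κ i • X (π i))
    twistedConj-X i = proj₂ (proj₂ (proj₂ (image i)))

    code-act-monomial : ∀ M i → code X (act g h M) i ≈ κ i * code X M (π i)
    code-act-monomial M i = begin
      code X (act g h M) i                  ≈⟨ code-act g h M i ⟩
      Tr (twistedConj g h (X i) ·ᴹ M)       ≈⟨ Tr-cong (·ᴹ-cong (twistedConj-X i) ≈ᴹ-refl) ⟩
      Tr ((κ i • X (π i)) ·ᴹ M)             ≈⟨ Tr-cong (•-·ᴹ (κ i) (X (π i)) M) ⟩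
      Tr (κ i • (X (π i) ·ᴹ M))             ≈⟨ Tr-• (κ i) (X (π i) ·ᴹ M) ⟩
      κ i * code X M (π i)                  ∎
      where open SetoidReasoning setoid

  π-inverse : ∀ {g h} (inv : IsInverse g h) i → π (IsInverse-sym inv) (π inv i) ≡ i
  π-inverse {g} {h} inv i =
    ≡.sym (X-distinct i _ (κ inv i * κ inv' j , *-≉0 (κ-≉0 inv i) (κ-≉0 inv' j) , X-i≈))
    where
    inv' = IsInverse-sym inv
    j = π inv i
    X-i≈ : X i ≈ᴹ ((κ inv i * κ inv' j) • X (π inv' j))
    X-i≈ = begin
      X i                                               ≈⟨ twistedConj-inverse inv (X i) ⟨
      twistedConj h g (twistedConj g h (X i))
        ≈⟨ twistedConj-cong h g (twistedConj-X inv i) ⟩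
      twistedConj h g (κ inv i • X j)                   ≈⟨ twistedConj-• h g (κ inv i) (X j) ⟩
      κ inv i • twistedConj h g (X j)                   ≈⟨ •-cong refl (twistedConj-X inv' j) ⟩
      κ inv i • (κ inv' j • X (π inv' j))               ≈⟨ •-assoc (κ inv i) (κ inv' j) _ ⟩
      (κ inv i * κ inv' j) • X (π inv' j)               ∎
      where open ≈ᴹ-Reasoning

  π-permutation : ∀ {g h} → IsInverse g h → Permutation′ N
  π-permutation inv = permutation (π inv) (π (IsInverse-sym inv))
    (π-inverse (IsInverse-sym inv)) (π-inverse inv)

  act-respects-code : ∀ g h → IsInverse g h → ∀ M M' →
    code X M ≈ⱽ code X M' → code X (act g h M) ≈ⱽ code X (act g h M')
  act-respects-code g h inv M M' cM≈cM' i = begin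
    code X (act g h M) i            ≈⟨ code-act-monomial inv M i ⟩
    κ inv i * code X M (π inv i)    ≈⟨ *-congˡ (cM≈cM' (π inv i)) ⟩
    κ inv i * code X M' (π inv i)   ≈⟨ code-act-monomial inv M' i ⟨
    code X (act g h M') i           ∎
    where open SetoidReasoning setoid

  act-isometry : ∀ g h → IsInverse g h → ∀ M M' →
    dist (code X (act g h M)) (code X (act g h M')) ≡ dist (code X M) (code X M')
  act-isometry g h inv M M' = dist-monomial (π-permutation inv) (κ-≉0 inv)
    (code-act-monomial inv M) (code-act-monomial inv M')

  fixes-code⇒commutes : ∀ g h → IsInverse g h → (∀ M → code X (act g h M) ≈ⱽ code X M) →
    ∀ Y → InΛ s Y → (mapᴹ σ g ·ᴹ Y) ≈ᴹ (Y ·ᴹ g)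
  fixes-code⇒commutes g h inv fixes Y Y∈Λ =
    twistedConj-fixed⇒commutes inv (fixes-Y (X-complete Y Y∈Λ))
    where
    fixes-X : ∀ i → twistedConj g h (X i) ≈ᴹ X i
    fixes-X i = Tr-·ᴹ-injective (λ M → trans (sym (code-act g h M i)) (fixes M i))
    fixes-Y : (∃ λ j → Proportional Y (X j)) → twistedConj g h Y ≈ᴹ Y
    fixes-Y (j , a , _ , Y≈aXⱼ) = begin
      twistedConj g h Y          ≈⟨ twistedConj-cong g h Y≈aXⱼ ⟩
      twistedConj g h (a • X j)  ≈⟨ twistedConj-• g h a (X j) ⟩
      a • twistedConj g h (X j)  ≈⟨ •-cong refl (fixes-X j) ⟩
      a • X j                    ≈⟨ Y≈aXⱼ ⟨
      Y                          ∎
      where open ≈ᴹ-Reasoning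

theorem1p3 : ∀ {c ℓ} (F : FiniteField c ℓ) → let open Over F in
    (n : ℕ) → 1 ≤ n → (s : Aut) → NonTrivial s →
    (N : ℕ) (X : Fin N → Mat (suc n)) → IsRepSystem s N X →
    let σ = Aut.σ s
        c = code X
        ρ = λ (g h M : Mat (suc n)) → c ((h ·ᴹ M) ·ᴹ mapᴹ σ g)
    in
    -- ρ(g) : c_M ↦ c_{g⁻¹ M g^σ} is well defined on the code
    (∀ g h → IsInverse g h → ∀ M M' → c M ≈ⱽ c M' → ρ g h M ≈ⱽ ρ g h M')
    -- it is a Hamming isometry of the code
    × (∀ g h → IsInverse g h → ∀ M M' → dist (ρ g h M) (ρ g h M') ≡ dist (c M) (c M'))
    -- it is an action: ρ(I) = id, ρ(g g') = ρ(g') ∘ ρ(g)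
    × (∀ M → ρ I I M ≈ⱽ c M)
    × (∀ g h g' h' k → IsInverse g h → IsInverse g' h' → IsInverse (g ·ᴹ g') k →
        ∀ M → ρ (g ·ᴹ g') k M ≈ⱽ ρ g' h' ((h ·ᴹ M) ·ᴹ mapᴹ σ g))
    -- its kernel is K_σ = {α I : α ∈ F_s}
    × (∀ g h → IsInverse g h →
        ((∀ M → ρ g h M ≈ⱽ c M) ⇔ ∃ (λ α → (σ α ≈ α) × (g ≈ᴹ scalar α))))
theorem1p3 F (suc n) (s≤s z≤n) s _ N X rep =
  act-respects-code , act-isometry , code-cong ∘ act-identity ,
  (λ g h g' h' k inv inv' inv'' M → code-cong (act-∘ g h g' h' k inv inv' inv'' M)) ,
  kernel
  where
  open Over F using (Aut; IsInverse; code; _≈_; _≈ⱽ_; _≈ᴹ_; scalar)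
  open Semilinear F s
  open ScalarKernel F s using (commutes-Λ⇒scalar)
  open CodeAction F s X rep

  kernel : ∀ g h → IsInverse g h →
    (∀ M → code X (act g h M) ≈ⱽ code X M) ⇔ ∃ λ α → Aut.σ s α ≈ α × g ≈ᴹ scalar α
  kernel g h inv = mk⇔ (commutes-Λ⇒scalar g ∘ fixes-code⇒commutes g h inv)
    (λ (α , σα≈α , g≈α) M → code-cong (act-scalar g h inv σα≈α g≈α M))
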